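{- Let $n,m$ be positive integers, let $K_n$ be the ordered complete graph on $n$ vertices and let $P_m$ be a path on $m$ vertices with an arbitrary total order on its vertices. Then $R_o(K_n,P_m)\le 2^{\lceil\log_2(n)\rceil\cdot(\lceil\log_2(m)\rceil+1)}$.
   Context: An ordered graph is a graph together with a total order on its vertices. An ordered graph $G$ is contained in an ordered graph $H$ if there is an injective map from the vertices of $G$ to the vertices of $H$ that preserves the order and maps edges to edges. The ordered Ramsey number $R_o(F,G)$ of ordered graphs $F$ and $G$ is the smallest $N$ such that every colouring of the edges of the ordered complete graph on $N$ vertices with the colours blue and red contains a blue copy of $F$ or a red copy of $G$. -}

module Defs where

open import Data.Nat using (ℕ; suc; _≤_)
open import Data.Fin using (Fin; toℕ; inject₁) renaming (_<_ to _<ᶠ_; suc to fsuc)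
open import Data.Bool using (Bool; true; false)
open import Data.Product using (Σ; _×_; ∃-syntax)
open import Data.Sum using (_⊎_)
open import Relation.Binary.PropositionalEquality using (_≡_)
open import Function.Bundles using (_↔_; Inverse)
open import Relation.Nullary using (yes; no)
open import Data.Fin using () renaming (_<?_ to _<ᶠ?_)

-- An ordered graph on k vertices: vertex set Fin k with its natural total
-- order, and an edge relation (read only on pairs i < j, i.e. as a simple graph).
record OrdGraph : Set₁ where
  field
    size : ℕ
    Edge : Fin size → Fin size → Set

open OrdGraph public

Adj : (G : OrdGraph) → Fin (size G) → Fin (size G) → Set
Adj G i j = Edge G i j ⊎ Edge G j i

K : ℕ → OrdGraph
K n = record { size = n ; Edge = λ i j → i <ᶠ j }

-- Ordered path on m vertices: the path σ(0) - σ(1) - ... - σ(m-1),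
-- where σ is an arbitrary permutation of Fin m (giving an arbitrary vertex order).
P : (m : ℕ) → (Fin m ↔ Fin m) → OrdGraph
P m σ = record { size = m ; Edge = λ u v →
  Σ (Fin m) λ i → Σ (Fin m) λ j → (toℕ j ≡ suc (toℕ i)) × (u ≡ Inverse.to σ i) × (v ≡ Inverse.to σ j) }

-- Red/blue colouring of the edges of the ordered complete graph on N vertices:
-- the colour of edge {i,j} with i < j is c i j (true = blue, false = red).
Colouring : ℕ → Set
Colouring N = Fin N → Fin N → Bool

colourOf : ∀ {N} → Colouring N → Fin N → Fin N → Bool
colourOf c i j with i <ᶠ? j
... | yes _ = c i j
... | no _  = c j i

MonoCopy : ∀ {N} → Colouring N → Bool → OrdGraph → Set
MonoCopy {N} c col G =
  Σ (Fin (size G) → Fin N) λ φ →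
    (∀ i j → i <ᶠ j → φ i <ᶠ φ j) ×
    (∀ i j → i <ᶠ j → Adj G i j → colourOf c (φ i) (φ j) ≡ col)

Arrows : ℕ → OrdGraph → OrdGraph → Set
Arrows N F G = (c : Colouring N) → MonoCopy c true F ⊎ MonoCopy c false G

RamseyLe : OrdGraph → OrdGraph → ℕ → Set
RamseyLe F G B = ∃[ N ] (N ≤ B × Arrows N F G)

-- Let D = 2 ^ (⌈log₂ m⌉ + 1) ≥ 2m. By induction on k, every increasing list of at least D ^ k
-- vertices contains a blue clique on 2 ^ k vertices, unless the colouring has a red copy of P_m.
-- For the step, cut the list into m consecutive blocks of 2 D ^ k vertices and assign to the
-- path vertex of vertex-order position p the p-th block. Walk along the path backwards, keeping
-- a set G of at least D ^ k vertices in the current block, each starting a red walk through the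
-- remaining blocks. Inside G the induction hypothesis gives a blue 2 ^ k-clique Q; the previous
-- block splits into the vertices that are blue to all of G and those with a red neighbour in G.
-- If the first part has D ^ k vertices, a blue 2 ^ k-clique in it together with Q is a blue
-- 2 ^ (k + 1)-clique; otherwise the second part is the next G. When the first path vertex is
-- reached, any vertex of G starts a red walk, and the block order makes it a red copy of P_m.

module Submission where

open import Defs
open import Data.Nat using (ℕ; _*_; _+_; _^_; _≤_)
open import Data.Nat.Logarithm using (⌈log₂_⌉)
open import Data.Fin using (Fin)
open import Function.Bundles using (_↔_)

open import Data.Nat as ℕ using (zero; suc; _<_; z≤n; s≤s; _≤?_; ⌊_/2⌋; ⌈_/2⌉; >-nonZero)
open import Data.Nat.Properties
open import Data.Nat.Tactic.RingSolver using (solve-∀)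
open import Data.Nat.Logarithm.Core using (⌈log2⌉)
open import Induction.WellFounded using (Acc; acc)
open import Data.Fin as Fin using (toℕ; inject≤) renaming (_<_ to _<ᶠ_; zero to fzero; suc to fsuc)
open import Data.Fin.Properties using (toℕ<n; toℕ-injective; toℕ-inject≤)
  renaming (<-asym to <ᶠ-asym; suc-injective to fsuc-injective)
open import Data.Vec.Functional using (head; tail) renaming (_∷_ to _∷ᵛ_; [] to []ᵛ)
open import Data.Bool using (true; false)
open import Data.Bool.Properties using (¬-not) renaming (_≟_ to _≟ᵇ_)
open import Data.List using (List; []; _∷_; _++_; length; take; drop; lookup; filter; allFin)
open import Data.List.Properties using (length-take; length-drop; length-tabulate; length-++)
open import Data.List.Membership.Propositional using (_∈_; find)
open import Data.List.Membership.Propositional.Properties using (∈-lookup; ∈-filter⁻; ∈-++⁻)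
open import Data.List.Relation.Binary.Subset.Propositional using (_⊆_)
open import Data.List.Relation.Binary.Subset.Propositional.Properties
  using (⊆-refl; ⊆-trans; xs⊆xs++ys; xs⊆ys++xs; ++⁺; filter-⊆)
import Data.List.Relation.Binary.Sublist.Propositional.Properties as Sublist
open import Data.List.Relation.Unary.Any using (here; there)
open import Data.List.Relation.Unary.All as All using (All; all?)
open import Data.List.Relation.Unary.All.Properties using (¬All⇒Any¬)
open import Data.List.Relation.Unary.AllPairs using (AllPairs; []; _∷_)
import Data.List.Relation.Unary.AllPairs.Properties as AllPairs
open import Data.Product using (Σ; _×_; _,_; proj₁; proj₂; ∃-syntax)
open import Data.Sum as Sum using (_⊎_; inj₁; inj₂)
open import Function.Base using (_∘_; id)
open import Function.Properties.Inverse using (Inverse⇒Injection)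
open import Function.Bundles using (Inverse; Injection)
open import Level using (0ℓ)
open import Relation.Binary.Definitions using (tri<; tri≈; tri>)
open import Relation.Binary.PropositionalEquality
open import Relation.Nullary using (yes; no; does; contradiction)
open import Relation.Unary using (Pred; Decidable)
open import Relation.Unary.Properties using (∁?)

n≤2^⌈log2⌉n : ∀ n (rec : Acc _<_ n) → n ≤ 2 ^ ⌈log2⌉ n rec
n≤2^⌈log2⌉n 0 _ = z≤n
n≤2^⌈log2⌉n 1 _ = ≤-refl
n≤2^⌈log2⌉n (suc (suc n)) (acc rec) = begin
  2 + n                              ≡⟨ cong (2 +_) (⌊n/2⌋+⌈n/2⌉≡n n) ⟨
  2 + (⌊ n /2⌋ + ⌈ n /2⌉)            ≤⟨ +-monoʳ-≤ 2 (+-monoˡ-≤ ⌈ n /2⌉ (⌊n/2⌋≤⌈n/2⌉ n)) ⟩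
  2 + (⌈ n /2⌉ + ⌈ n /2⌉)            ≡⟨ 2+[h+h]≡2*[1+h] ⌈ n /2⌉ ⟩
  2 * suc ⌈ n /2⌉                    ≤⟨ *-monoʳ-≤ 2 (n≤2^⌈log2⌉n (suc ⌈ n /2⌉) (rec (⌈n/2⌉<n n))) ⟩
  2 ^ ⌈log2⌉ (suc (suc n)) (acc rec) ∎
  where
  open ≤-Reasoning
  2+[h+h]≡2*[1+h] : ∀ h → 2 + (h + h) ≡ 2 * suc h
  2+[h+h]≡2*[1+h] = solve-∀

n≤2^⌈log₂n⌉ : ∀ n → n ≤ 2 ^ ⌈log₂ n ⌉
n≤2^⌈log₂n⌉ n = n≤2^⌈log2⌉n n _

2*m≤a+b⇒m≤a⊎m≤b : ∀ m {a b} → 2 * m ≤ a + b → m ≤ a ⊎ m ≤ b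
2*m≤a+b⇒m≤a⊎m≤b m {a} {b} 2m≤a+b with m ≤? a
... | yes m≤a = inj₁ m≤a
... | no m≰a = inj₂ (+-cancelˡ-≤ a m b (begin
  a + m  ≤⟨ +-monoˡ-≤ m (<⇒≤ (≰⇒> m≰a)) ⟩
  m + m  ≡⟨ cong (m +_) (+-identityʳ m) ⟨
  2 * m  ≤⟨ 2m≤a+b ⟩
  a + b  ∎))
  where open ≤-Reasoning

module _ {A : Set} where

  Before : (A → A → Set) → List A → List A → Set
  Before R X Y = ∀ {x y} → x ∈ X → y ∈ Y → R x y

  Separated : (A → A → Set) → List A → List A → Set
  Separated R X Y = Before R X Y ⊎ Before R Y X

  separated-⊆ : ∀ {R : A → A → Set} {X Y X′ Y′} → X′ ⊆ X → Y′ ⊆ Y →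
                Separated R X Y → Separated R X′ Y′
  separated-⊆ X′⊆X Y′⊆Y (inj₁ X<Y) = inj₁ λ x∈ y∈ → X<Y (X′⊆X x∈) (Y′⊆Y y∈)
  separated-⊆ X′⊆X Y′⊆Y (inj₂ Y<X) = inj₂ λ y∈ x∈ → Y<X (Y′⊆Y y∈) (X′⊆X x∈)

  ++-⊆ : ∀ {X Y Z : List A} → X ⊆ Z → Y ⊆ Z → X ++ Y ⊆ Z
  ++-⊆ {X} X⊆Z Y⊆Z x∈ = Sum.[ X⊆Z , Y⊆Z ] (∈-++⁻ X x∈)

  take-⊆ : ∀ n (xs : List A) → take n xs ⊆ xs
  take-⊆ n xs = Sublist.Any-resp-⊆ (Sublist.take-⊆ n xs)

  drop-⊆ : ∀ n (xs : List A) → drop n xs ⊆ xs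
  drop-⊆ n xs = Sublist.Any-resp-⊆ (Sublist.drop-⊆ n xs)

  take-before-drop : ∀ {R : A → A → Set} n {xs} → AllPairs R xs → Before R (take n xs) (drop n xs)
  take-before-drop (suc n) {x ∷ xs} (x<xs ∷ _)     (here refl) y∈ = All.lookup x<xs (drop-⊆ n xs y∈)
  take-before-drop (suc n) {x ∷ xs} (_    ∷ sorted) (there x∈)  y∈ = take-before-drop n sorted x∈ y∈

  AllPairs-lookup : ∀ {R : A → A → Set} {xs} → AllPairs R xs →
                    ∀ {i j} → i <ᶠ j → R (lookup xs i) (lookup xs j)
  AllPairs-lookup (x<xs ∷ _)    {fzero}  {fsuc j} _         = All.lookup x<xs (∈-lookup j)
  AllPairs-lookup (_    ∷ pairs) {fsuc i} {fsuc j} (s≤s i<j) = AllPairs-lookup pairs i<j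

  length-filter+∁ : ∀ {P : Pred A 0ℓ} (P? : Decidable P) xs →
                    length (filter P? xs) + length (filter (∁? P?) xs) ≡ length xs
  length-filter+∁ P? []       = refl
  length-filter+∁ P? (x ∷ xs) with does (P? x)
  ... | true  = cong suc (length-filter+∁ P? xs)
  ... | false = trans (+-suc _ _) (cong suc (length-filter+∁ P? xs))

module Chunks {A : Set} (L : ℕ) where

  chunk : ℕ → List A → List A
  chunk zero    = take L
  chunk (suc p) = chunk p ∘ drop L

  chunk-⊆ : ∀ p xs → chunk p xs ⊆ xs
  chunk-⊆ zero    xs = take-⊆ L xs
  chunk-⊆ (suc p) xs = ⊆-trans (chunk-⊆ p (drop L xs)) (drop-⊆ L xs)

  chunk-sorted : ∀ {R : A → A → Set} p {xs} → AllPairs R xs → AllPairs R (chunk p xs)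
  chunk-sorted zero    sorted = AllPairs.take⁺ L sorted
  chunk-sorted (suc p) sorted = chunk-sorted p (AllPairs.drop⁺ L sorted)

  chunk-length : ∀ p xs → suc p * L ≤ length xs → L ≤ length (chunk p xs)
  chunk-length zero xs L≤ = begin
    L                  ≤⟨ ⊓-glb ≤-refl (m+n≤o⇒m≤o L L≤) ⟩
    L ℕ.⊓ length xs    ≡⟨ length-take L xs ⟨
    length (take L xs) ∎
    where open ≤-Reasoning
  chunk-length (suc p) xs L≤ = chunk-length p (drop L xs) (begin
    suc p * L          ≤⟨ m+n≤o⇒m≤o∸n (suc p * L) (≤-trans (≤-reflexive (+-comm (suc p * L) L)) L≤) ⟩
    length xs ℕ.∸ L    ≡⟨ length-drop L xs ⟨
    length (drop L xs) ∎)
    where open ≤-Reasoning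

  chunk-before : ∀ {R : A → A → Set} p q {xs} → AllPairs R xs → p < q →
                 Before R (chunk p xs) (chunk q xs)
  chunk-before zero    (suc q) {xs} sorted _ x∈ y∈ =
    take-before-drop L sorted x∈ (chunk-⊆ q (drop L xs) y∈)
  chunk-before (suc p) (suc q) sorted (s≤s p<q) = chunk-before p q (AllPairs.drop⁺ L sorted) p<q

  chunk-separated : ∀ {R : A → A → Set} {p q xs} → AllPairs R xs → p ≢ q →
                    Separated R (chunk p xs) (chunk q xs)
  chunk-separated {p = p} {q} sorted p≢q with <-cmp p q
  ... | tri< p<q _   _   = inj₁ (chunk-before p q sorted p<q)
  ... | tri≈ _   p≡q _   = contradiction p≡q p≢q
  ... | tri> _   _   q<p = inj₂ (chunk-before q p sorted q<p)

module _ {A : Set} (R : A → A → Set) where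

  Chain : ∀ {r} → (Fin r → A) → Set
  Chain w = ∀ i j → toℕ j ≡ suc (toℕ i) → R (w i) (w j)

  chain-[x] : ∀ x → Chain (x ∷ᵛ []ᵛ)
  chain-[x] x fzero fzero ()

  chain-∷ : ∀ {r x} {w : Fin (suc r) → A} → R x (head w) → Chain w → Chain (x ∷ᵛ w)
  chain-∷ x-w _     fzero    (fsuc fzero)    refl = x-w
  chain-∷ _   chain (fsuc i) (fsuc j)        eq   = chain i j (suc-injective eq)
  chain-∷ _   _     fzero    fzero           ()
  chain-∷ _   _     fzero    (fsuc (fsuc _)) ()
  chain-∷ _   _     (fsuc _) fzero           ()

Sorted : ∀ {N} → List (Fin N) → Set
Sorted = AllPairs _<ᶠ_

module _ {N : ℕ} (c : Colouring N) where

  colourOf-sym : ∀ {a b} → a <ᶠ b → colourOf c b a ≡ colourOf c a b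
  colourOf-sym {a} {b} a<b with a Fin.<? b | b Fin.<? a
  ... | yes _  | no _    = refl
  ... | _      | yes b<a = contradiction b<a (<ᶠ-asym a<b)
  ... | no a≮b | no _    = contradiction a<b a≮b

  BlueEdge : Fin N → Fin N → Set
  BlueEdge a b = a <ᶠ b × colourOf c a b ≡ true

  RedEdge : Fin N → Fin N → Set
  RedEdge a b = colourOf c a b ≡ false

  HasBlueClique : ℕ → List (Fin N) → Set
  HasBlueClique t X = Σ (List (Fin N)) λ qs → qs ⊆ X × AllPairs BlueEdge qs × t ≤ length qs

  hasBlueClique-singleton : ∀ {x X} → x ∈ X → HasBlueClique 1 X
  hasBlueClique-singleton x∈X = _ , (λ { (here refl) → x∈X ; (there ()) }) , All.[] ∷ [] , ≤-refl

  hasBlueClique-mono : ∀ {s t X Y} → s ≤ t → X ⊆ Y → HasBlueClique t X → HasBlueClique s Y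
  hasBlueClique-mono s≤t X⊆Y (qs , qs⊆X , clique , t≤) =
    qs , ⊆-trans qs⊆X X⊆Y , clique , ≤-trans s≤t t≤

  hasBlueClique-++ : ∀ {s t X Y} → Before _<ᶠ_ X Y →
    (∀ {x y} → x ∈ X → y ∈ Y → colourOf c x y ≡ true) →
    HasBlueClique s X → HasBlueClique t Y → HasBlueClique (s + t) (X ++ Y)
  hasBlueClique-++ X<Y blue (qs , qs⊆X , qs-clique , s≤) (rs , rs⊆Y , rs-clique , t≤) =
    qs ++ rs , ++⁺ qs⊆X rs⊆Y ,
    AllPairs.++⁺ qs-clique rs-clique (All.tabulate λ q∈ → All.tabulate λ r∈ →
      X<Y (qs⊆X q∈) (rs⊆Y r∈) , blue (qs⊆X q∈) (rs⊆Y r∈)) ,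
    ≤-trans (+-mono-≤ s≤ t≤) (≤-reflexive (sym (length-++ qs)))

  hasBlueClique-∪ : ∀ {s t X Y} → Separated _<ᶠ_ X Y →
    (∀ {x y} → x ∈ X → y ∈ Y → colourOf c x y ≡ true) →
    HasBlueClique s X → HasBlueClique t Y → HasBlueClique (s + t) (X ++ Y)
  hasBlueClique-∪ (inj₁ X<Y) blue Q₁ Q₂ = hasBlueClique-++ X<Y blue Q₁ Q₂
  hasBlueClique-∪ {s} {t} {X} {Y} (inj₂ Y<X) blue Q₁ Q₂ =
    hasBlueClique-mono (≤-reflexive (+-comm s t)) (++-⊆ (xs⊆ys++xs Y X) (xs⊆xs++ys X Y))
      (hasBlueClique-++ Y<X (λ y∈ x∈ → trans (sym (colourOf-sym (Y<X y∈ x∈))) (blue x∈ y∈)) Q₂ Q₁)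

  hasBlueClique⇒copy : ∀ {n X} → HasBlueClique n X → MonoCopy c true (K n)
  hasBlueClique⇒copy {n} (qs , _ , clique , n≤) =
    φ , (λ _ _ → proj₁ ∘ blue) , (λ _ _ i<j _ → proj₂ (blue i<j))
    where
    φ : Fin n → Fin N
    φ i = lookup qs (inject≤ i n≤)
    blue : ∀ {i j} → i <ᶠ j → BlueEdge (φ i) (φ j)
    blue {i} {j} i<j =
      AllPairs-lookup clique (subst₂ _<_ (sym (toℕ-inject≤ i n≤)) (sym (toℕ-inject≤ j n≤)) i<j)

  redWalk⇒copy : ∀ {m} (σ : Fin m ↔ Fin m) (w : Fin m → Fin N) → let open Inverse σ in
    (∀ {u v} → u <ᶠ v → w (from u) <ᶠ w (from v)) → Chain RedEdge w → MonoCopy c false (P m σ)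
  redWalk⇒copy {m} σ w increasing red = w ∘ from , (λ _ _ → increasing) , adjacentRed
    where
    open Inverse σ
    pathEdgeRed : ∀ {u v} → Edge (P m σ) u v → RedEdge (w (from u)) (w (from v))
    pathEdgeRed (i , j , j≡1+i , refl , refl)
      rewrite strictlyInverseʳ i | strictlyInverseʳ j = red i j j≡1+i
    adjacentRed : ∀ u v → u <ᶠ v → Adj (P m σ) u v → RedEdge (w (from u)) (w (from v))
    adjacentRed _ _ _   (inj₁ uv) = pathEdgeRed uv
    adjacentRed _ _ u<v (inj₂ vu) = trans (sym (colourOf-sym (increasing u<v))) (pathEdgeRed vu)

  IsRedWalk : ∀ {r} → (Fin r → List (Fin N)) → (Fin r → Fin N) → Set
  IsRedWalk B w = (∀ i → w i ∈ B i) × Chain RedEdge w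

  redWalk-[x] : ∀ {B : Fin 1 → List (Fin N)} {x} → x ∈ head B → IsRedWalk B (x ∷ᵛ []ᵛ)
  redWalk-[x] {x = x} x∈B = (λ { fzero → x∈B }) , chain-[x] RedEdge x

  redWalk-∷ : ∀ {r} {B : Fin (suc (suc r)) → List (Fin N)} {x w} →
    x ∈ head B → RedEdge x (head w) → IsRedWalk (tail B) w → IsRedWalk B (x ∷ᵛ w)
  redWalk-∷ x∈B x-w (w∈B , chain) = (λ { fzero → x∈B ; (fsuc i) → w∈B i }) , chain-∷ RedEdge x-w chain

  BlueTo : List (Fin N) → Fin N → Set
  BlueTo G x = All (λ y → colourOf c x y ≡ true) G

  blueTo? : ∀ G → Decidable (BlueTo G)
  blueTo? G x = all? (λ y → colourOf c x y ≟ᵇ true) G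

  bluePart redPart : List (Fin N) → List (Fin N) → List (Fin N)
  bluePart G = filter (blueTo? G)
  redPart  G = filter (∁? (blueTo? G))

  redPart-red : ∀ {G C x} → x ∈ redPart G C → ∃[ y ] y ∈ G × RedEdge x y
  redPart-red {G} {C} {x} x∈R
    with find (¬All⇒Any¬ (λ y → colourOf c x y ≟ᵇ true) G (proj₂ (∈-filter⁻ (∁? (blueTo? G)) {xs = C} x∈R)))
  ... | y , y∈G , ¬blue = y , y∈G , ¬-not ¬blue

module RedWalks {N : ℕ} (c : Colouring N) (M t : ℕ) {Out : Set}
  (cliqueOr : ∀ ys → Sorted ys → M ≤ length ys → HasBlueClique c t ys ⊎ Out)
  (xs : List (Fin N)) where

  StartsRedWalk : ∀ {r} → (Fin (suc r) → List (Fin N)) → Fin N → Set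
  StartsRedWalk {r} B x = Σ (Fin r → Fin N) λ w → IsRedWalk c B (x ∷ᵛ w)

  RedStarts : ∀ {r} → (Fin (suc r) → List (Fin N)) → Set
  RedStarts B = Σ (List (Fin N)) λ G → Sorted G × M ≤ length G × (∀ {x} → x ∈ G → StartsRedWalk B x)

  starts⊆head : ∀ {r} {B : Fin (suc r) → List (Fin N)} {G} →
                (∀ {x} → x ∈ G → StartsRedWalk B x) → G ⊆ head B
  starts⊆head walks x∈G = proj₁ (proj₂ (walks x∈G)) fzero

  redPart-starts : ∀ {r} (B : Fin (suc (suc r)) → List (Fin N)) {G} →
    (∀ {y} → y ∈ G → StartsRedWalk (tail B) y) → ∀ {x} → x ∈ redPart c G (head B) → StartsRedWalk B x
  redPart-starts B {G} walks x∈R with redPart-red c {C = head B} x∈R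
  ... | y , y∈G , x-y with walks y∈G
  ... | w , walk = y ∷ᵛ w , redWalk-∷ c (proj₁ (∈-filter⁻ (∁? (blueTo? c G)) x∈R)) x-y walk

  extend : ∀ {r} (B : Fin (suc (suc r)) → List (Fin N)) →
    Sorted (head B) → 2 * M ≤ length (head B) → Separated _<ᶠ_ (head B) (B (fsuc fzero)) →
    (G : List (Fin N)) → Sorted G → (∀ {y} → y ∈ G → StartsRedWalk (tail B) y) → HasBlueClique c t G →
    HasBlueClique c (t + t) (head B ++ G) ⊎ Out ⊎ RedStarts B
  extend B sorted long sep G _ walks clique
    with 2*m≤a+b⇒m≤a⊎m≤b M (≤-trans long (≤-reflexive (sym (length-filter+∁ (blueTo? c G) (head B)))))
  ... | inj₂ M≤|red| =
    inj₂ (inj₂ (redPart c G (head B) , AllPairs.filter⁺ _ sorted , M≤|red| , redPart-starts B walks))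
  ... | inj₁ M≤|blue| with cliqueOr (bluePart c G (head B)) (AllPairs.filter⁺ _ sorted) M≤|blue|
  ...   | inj₂ out        = inj₂ (inj₁ out)
  ...   | inj₁ blueClique = inj₁ (hasBlueClique-mono c ≤-refl (++⁺ (filter-⊆ _ (head B)) ⊆-refl)
            (hasBlueClique-∪ c (separated-⊆ (filter-⊆ _ (head B)) (starts⊆head walks) sep)
              (λ x∈ y∈ → All.lookup (proj₂ (∈-filter⁻ (blueTo? c G) {xs = head B} x∈)) y∈)
              blueClique clique))

  redWalks : ∀ {r} (B : Fin (suc r) → List (Fin N)) →
    (∀ i → Sorted (B i)) → (∀ i → 2 * M ≤ length (B i)) →
    (∀ i j → i ≢ j → Separated _<ᶠ_ (B i) (B j)) → (∀ i → B i ⊆ xs) →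
    HasBlueClique c (t + t) xs ⊎ Out ⊎ RedStarts B
  redWalks {zero} B sorted long _ _ =
    inj₂ (inj₂ (head B , sorted fzero , m+n≤o⇒m≤o M (long fzero) , λ x∈B → []ᵛ , redWalk-[x] c x∈B))
  redWalks {suc r} B sorted long sep B⊆xs
    with redWalks (tail B) (sorted ∘ fsuc) (long ∘ fsuc)
           (λ i j i≢j → sep (fsuc i) (fsuc j) (i≢j ∘ fsuc-injective)) (B⊆xs ∘ fsuc)
  ... | inj₁ clique     = inj₁ clique
  ... | inj₂ (inj₁ out) = inj₂ (inj₁ out)
  ... | inj₂ (inj₂ (G , G-sorted , G-long , walks)) with cliqueOr G G-sorted G-long
  ...   | inj₂ out    = inj₂ (inj₁ out)
  ...   | inj₁ clique =
    Sum.map₁ (hasBlueClique-mono c ≤-refl (++-⊆ (B⊆xs fzero) (⊆-trans (starts⊆head walks) (B⊆xs (fsuc fzero)))))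
      (extend B (sorted fzero) (long fzero) (sep fzero (fsuc fzero) λ ()) G G-sorted walks clique)

module CliqueOrPath {N : ℕ} (c : Colouring N) {r : ℕ} (σ : Fin (suc r) ↔ Fin (suc r))
  (D : ℕ) (2m≤D : 2 * suc r ≤ D) where

  open Inverse σ using (to; from; strictlyInverseˡ)

  Path : Set
  Path = MonoCopy c false (P (suc r) σ)

  0<D^k : ∀ k → 0 < D ^ k
  0<D^k = m^n>0 D {{>-nonZero (≤-trans (s≤s z≤n) 2m≤D)}}

  cliqueOrPath : ∀ k xs → Sorted xs → D ^ k ≤ length xs → HasBlueClique c (2 ^ k) xs ⊎ Path
  cliqueOrPath zero (x ∷ _) _ _ = inj₁ (hasBlueClique-singleton c (here refl))
  cliqueOrPath (suc k) xs sorted long =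
    conclude (redWalks blocks (λ i → chunk-sorted (toℕ (to i)) sorted) blocks-long blocks-separated
                              (λ i → chunk-⊆ (toℕ (to i)) xs))
    where
    open RedWalks c (D ^ k) (2 ^ k) (cliqueOrPath k) xs
    open Chunks (2 * D ^ k)

    blocks : Fin (suc r) → List (Fin N)
    blocks i = chunk (toℕ (to i)) xs

    blocks-long : ∀ i → 2 * D ^ k ≤ length (blocks i)
    blocks-long i = chunk-length (toℕ (to i)) xs (begin
      suc (toℕ (to i)) * (2 * D ^ k)  ≤⟨ *-monoˡ-≤ (2 * D ^ k) (toℕ<n (to i)) ⟩
      suc r * (2 * D ^ k)             ≡⟨ *-assoc (suc r) 2 (D ^ k) ⟨
      suc r * 2 * D ^ k               ≡⟨ cong (_* D ^ k) (*-comm (suc r) 2) ⟩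
      2 * suc r * D ^ k               ≤⟨ *-monoˡ-≤ (D ^ k) 2m≤D ⟩
      D ^ suc k                       ≤⟨ long ⟩
      length xs                       ∎)
      where open ≤-Reasoning

    blocks-separated : ∀ i j → i ≢ j → Separated _<ᶠ_ (blocks i) (blocks j)
    blocks-separated i j i≢j =
      chunk-separated sorted (i≢j ∘ Injection.injective (Inverse⇒Injection σ) ∘ toℕ-injective)

    walk-increasing : ∀ {w : Fin (suc r) → Fin N} → (∀ i → w i ∈ blocks i) →
                      ∀ {u v} → u <ᶠ v → w (from u) <ᶠ w (from v)
    walk-increasing {w} w∈blocks {u} {v} u<v =
      chunk-before (toℕ u) (toℕ v) sorted u<v (w∈chunk u) (w∈chunk v)
      where
      w∈chunk : ∀ u → w (from u) ∈ chunk (toℕ u) xs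
      w∈chunk u = subst (λ z → w (from u) ∈ chunk (toℕ z) xs) (strictlyInverseˡ u) (w∈blocks (from u))

    conclude : HasBlueClique c (2 ^ k + 2 ^ k) xs ⊎ Path ⊎ RedStarts blocks →
               HasBlueClique c (2 ^ suc k) xs ⊎ Path
    conclude (inj₁ clique) =
      inj₁ (hasBlueClique-mono c (≤-reflexive (cong (2 ^ k +_) (+-identityʳ (2 ^ k)))) ⊆-refl clique)
    conclude (inj₂ (inj₁ path)) = inj₂ path
    conclude (inj₂ (inj₂ ([] , _ , D^k≤0 , _))) = contradiction D^k≤0 (<⇒≱ (0<D^k k))
    conclude (inj₂ (inj₂ (x ∷ _ , _ , _ , walks))) with walks (here refl)
    ... | w , w∈blocks , red = inj₂ (redWalk⇒copy c σ (x ∷ᵛ w) (walk-increasing w∈blocks) red)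

theorem2p5 : (n m : ℕ) → 1 ≤ n → 1 ≤ m → (σ : Fin m ↔ Fin m) →
    RamseyLe (K n) (P m σ) (2 ^ (⌈log₂ n ⌉ * (⌈log₂ m ⌉ + 1)))
theorem2p5 n zero _ () σ
theorem2p5 n (suc r) _ _ σ = N , ≤-refl , arrows
  where
  b D N : ℕ
  b = ⌈log₂ suc r ⌉
  D = 2 ^ (b + 1)
  N = 2 ^ (⌈log₂ n ⌉ * (b + 1))

  2m≤D : 2 * suc r ≤ D
  2m≤D = ≤-trans (*-monoʳ-≤ 2 (n≤2^⌈log₂n⌉ (suc r))) (≤-reflexive (cong (2 ^_) (+-comm 1 b)))

  D^a≡N : D ^ ⌈log₂ n ⌉ ≡ N
  D^a≡N = trans (^-*-assoc 2 (b + 1) ⌈log₂ n ⌉) (cong (2 ^_) (*-comm (b + 1) ⌈log₂ n ⌉))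

  arrows : Arrows N (K n) (P (suc r) σ)
  arrows c = Sum.map₁ (hasBlueClique⇒copy c ∘ hasBlueClique-mono c (n≤2^⌈log₂n⌉ n) ⊆-refl)
    (CliqueOrPath.cliqueOrPath c σ D 2m≤D ⌈log₂ n ⌉ (allFin N) (AllPairs.tabulate⁺-< id)
      (≤-reflexive (trans D^a≡N (sym (length-tabulate id)))))
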